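{- Let $n\ge1$. The set $SE_n$ listed in Co-Reflected Gray Code order $\prec_c$ is a $1$-Gray code: consecutive sequences in the list differ in at most one position.
   Context: $SE_n$ is the set of sequences $s_1\ldots s_n$ of non-negative integers with $s_1=0$ and $0\le s_{k+1}\le k$ for $1\le k<n$. Co-Reflected Gray Code order on length-$n$ sequences: $s\prec_c t$ if, with $k$ the rightmost position where $s$ and $t$ differ, either $\sum_{i=k+1}^n s_i+(n-k)$ is even and $s_k>t_k$, or $\sum_{i=k+1}^n s_i+(n-k)$ is odd and $s_k<t_k$. A list is a $d$-Gray code if the Hamming distance between consecutive sequences is at most $d$. -}

module Defs where

open import Data.Nat using (ℕ; zero; suc; _+_; _∸_; _≤_; _<_; _%_)
open import Data.Nat.Properties using (_≟_)
open import Data.Fin using (Fin; toℕ)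
import Data.Fin as F
open import Data.List using (List; map; filter; length; allFin)
open import Data.Nat.ListAction using (sum)
open import Data.Product using (Σ; _×_)
open import Data.Sum using (_⊎_)
open import Relation.Nullary using (¬_)
open import Relation.Nullary.Decidable using (¬?)
open import Relation.Binary.PropositionalEquality using (_≡_; _≢_)

-- A length-n sequence s_1 … s_n, stored 0-indexed: position i : Fin n
-- is the paper's position i+1.
Seq : ℕ → Set
Seq n = Fin n → ℕ

-- Membership in SE_n: s_1 = 0 and s_{k+1} ≤ k for 1 ≤ k < n.
-- 0-indexed this is exactly  s i ≤ i  for all i.
SE : (n : ℕ) → Seq n → Set
SE n s = (i : Fin n) → s i ≤ toℕ i

suffixSum : {n : ℕ} → Seq n → Fin n → ℕ
suffixSum {n} s j = sum (map s (filter (λ i → j F.<? i) (allFin n)))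

RightmostDiff : {n : ℕ} → Seq n → Seq n → Fin n → Set
RightmostDiff s t j = (s j ≢ t j) × ((i : Fin _) → j F.< i → s i ≡ t i)

-- Co-Reflected Gray Code order.  With 0-indexed j, the paper's k is j+1,
-- so the quantity is  sum_{i>k} s_i + (n - k).
_≺c_ : {n : ℕ} → Seq n → Seq n → Set
_≺c_ {n} s t = Σ (Fin n) λ j → RightmostDiff s t j ×
  (( ((suffixSum s j + (n ∸ suc (toℕ j))) % 2 ≡ 0) × t j < s j)
   ⊎ (((suffixSum s j + (n ∸ suc (toℕ j))) % 2 ≡ 1) × s j < t j))

hamming : {n : ℕ} → Seq n → Seq n → ℕ
hamming {n} s t = length (filter (λ i → ¬? (s i ≟ t i)) (allFin n))

-- Let j be the rightmost position where s ≺c t differ, with no element of SE_n strictly between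
-- them. Moving s_j to a value strictly between s_j and t_j would produce such an element, so s_j and
-- t_j differ by one. If s and t also differed below j, let i be the largest such position: the suffix
-- sums after i then differ by exactly one, so the parity rule orders the values at i in opposite
-- directions for s and for t. As s_i ≠ t_i both lie in [0, i], either s_i has a successor or t_i a
-- predecessor there, and changing that one entry gives a sequence strictly between s and t.

module Submission where

open import Defs
open import Data.Nat using (ℕ; zero; suc; _+_; _∸_; _≤_; _<_; _%_; z≤n; s≤s)
open import Data.Nat.Properties
  using (_≟_; +-suc; <-irrefl; ≤-trans; ≤∧≢⇒<; m≤n⇒m<n∨m≡n; n≤1+n; n<1+n)
open import Data.Fin using (Fin; toℕ)
import Data.Fin as F
open import Data.Fin.Induction using (>-wellFounded)
open import Data.Fin.Properties using (<-cmp; <-trans; <⇒≢) renaming (_≟_ to _≟ᶠ_)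
open import Data.List using (List; []; _∷_; map; length; allFin)
open import Data.List.Properties using (map-cong-local)
open import Data.Nat.ListAction using (sum)
open import Data.List.Membership.Propositional using (_∈_)
open import Data.List.Membership.Propositional.Properties using (∈-filter⁺; ∈-filter⁻; ∈-allFin)
open import Data.List.Relation.Unary.Any using (here; there)
open import Data.List.Relation.Unary.All as All using (All; []; _∷_)
open import Data.List.Relation.Unary.All.Properties using (all-filter)
open import Data.List.Relation.Unary.AllPairs using ([]; _∷_)
open import Data.List.Relation.Unary.Unique.Propositional using (Unique)
open import Data.List.Relation.Unary.Unique.Propositional.Properties using (allFin⁺; filter⁺)
open import Data.Product using (∃-syntax; _×_; _,_; proj₁; proj₂)
open import Data.Sum using (_⊎_; inj₁; inj₂)
open import Data.Vec.Functional using (updateAt)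
open import Data.Vec.Functional.Properties using (updateAt-updates; updateAt-minimal)
open import Function using (const; _$_)
import Induction.WellFounded as WF
open import Relation.Binary.Definitions using (tri<; tri≈; tri>)
open import Relation.Nullary using (¬_; Dec; yes; no; ¬?; contradiction)
open import Data.Empty using (⊥; ⊥-elim)
open import Relation.Nullary.Decidable using (decidable-stable)
open import Relation.Binary.PropositionalEquality
  using (_≡_; _≢_; refl; sym; trans; cong; subst; subst₂)

private
  variable
    n a b m p q v : ℕ
    i j k : Fin n
    s t u : Seq n

Adjacent : ℕ → ℕ → Set
Adjacent a b = a ≡ suc b ⊎ b ≡ suc a

adjacent-+ˡ : ∀ c → Adjacent a b → Adjacent (c + a) (c + b)
adjacent-+ˡ {b = b} c (inj₁ refl) = inj₁ (+-suc c b)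
adjacent-+ˡ {a = a} c (inj₂ refl) = inj₂ (+-suc c a)

adjacent-+ʳ : ∀ c → Adjacent a b → Adjacent (a + c) (b + c)
adjacent-+ʳ c (inj₁ refl) = inj₁ refl
adjacent-+ʳ c (inj₂ refl) = inj₂ refl

Opposite : ℕ → ℕ → Set
Opposite p q = (p ≡ 0 × q ≡ 1) ⊎ (p ≡ 1 × q ≡ 0)

opposite-sym : Opposite p q → Opposite q p
opposite-sym (inj₁ (p≡0 , q≡1)) = inj₂ (q≡1 , p≡0)
opposite-sym (inj₂ (p≡1 , q≡0)) = inj₁ (q≡0 , p≡1)

suc-%2-opposite : ∀ m → Opposite (suc m % 2) (m % 2)
suc-%2-opposite zero          = inj₂ (refl , refl)
suc-%2-opposite (suc zero)    = inj₁ (refl , refl)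
suc-%2-opposite (suc (suc m)) = suc-%2-opposite m

adjacent⇒opposite-%2 : Adjacent a b → Opposite (a % 2) (b % 2)
adjacent⇒opposite-%2 {b = b} (inj₁ refl) = suc-%2-opposite b
adjacent⇒opposite-%2 {a = a} (inj₂ refl) = opposite-sym (suc-%2-opposite a)

sum-map-cong : ∀ {A : Set} {f g : A → ℕ} {xs : List A} →
  (∀ {x} → x ∈ xs → f x ≡ g x) → sum (map f xs) ≡ sum (map g xs)
sum-map-cong f≡g = cong sum (map-cong-local (All.tabulate f≡g))

sum-map-adjacent : ∀ {A : Set} {f g : A → ℕ} {x : A} {xs : List A} →
  Unique xs → x ∈ xs → Adjacent (f x) (g x) → (∀ {y} → y ∈ xs → y ≢ x → f y ≡ g y) →
  Adjacent (sum (map f xs)) (sum (map g xs))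
sum-map-adjacent {g = g} {xs = _ ∷ xs} (x∉xs ∷ _) (here refl) fx~gx f≡g
  rewrite sum-map-cong {xs = xs} (λ y∈xs → f≡g (there y∈xs) (λ { refl → All.lookup x∉xs y∈xs refl }))
  = adjacent-+ʳ (sum (map g xs)) fx~gx
sum-map-adjacent {g = g} {xs = y ∷ _} (y∉xs ∷ xs-unique) (there x∈xs) fx~gx f≡g
  rewrite f≡g (here refl) (λ { refl → All.lookup y∉xs x∈xs refl })
  = adjacent-+ˡ (g y) (sum-map-adjacent xs-unique x∈xs fx~gx (λ z∈xs → f≡g (there z∈xs)))

AgreeAbove : Fin n → Seq n → Seq n → Set
AgreeAbove {n} j s t = (k : Fin n) → j F.< k → s k ≡ t k

suffixSum-cong : ∀ {s t : Seq n} {i} → AgreeAbove i s t → suffixSum s i ≡ suffixSum t i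
suffixSum-cong {n} {i = i} s≡t =
  sum-map-cong (λ k∈ → s≡t _ (proj₂ (∈-filter⁻ (i F.<?_) {xs = allFin n} k∈)))

suffixSum-adjacent : i F.< j → Adjacent (s j) (t j) →
  ((k : Fin n) → i F.< k → k ≢ j → s k ≡ t k) → Adjacent (suffixSum s i) (suffixSum t i)
suffixSum-adjacent {n = n} {i = i} {j = j} i<j sj~tj s≡t =
  sum-map-adjacent (filter⁺ (i F.<?_) (allFin⁺ n)) (∈-filter⁺ (i F.<?_) (∈-allFin j) i<j) sj~tj
    (λ k∈ k≢j → s≡t _ (proj₂ (∈-filter⁻ (i F.<?_) {xs = allFin n} k∈)) k≢j)

suffixParity : Seq n → Fin n → ℕ
suffixParity {n} s j = (suffixSum s j + (n ∸ suc (toℕ j))) % 2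

suffixParity-cong : ∀ {s t : Seq n} {i} → AgreeAbove i s t → suffixParity s i ≡ suffixParity t i
suffixParity-cong {n} {i = i} s≡t = cong (λ x → (x + (n ∸ suc (toℕ i))) % 2) (suffixSum-cong s≡t)

suffixParity-opposite : i F.< j → Adjacent (s j) (t j) →
  ((k : Fin n) → i F.< k → k ≢ j → s k ≡ t k) → Opposite (suffixParity s i) (suffixParity t i)
suffixParity-opposite i<j sj~tj s≡t =
  adjacent⇒opposite-%2 (adjacent-+ʳ _ (suffixSum-adjacent i<j sj~tj s≡t))

-- How ≺c compares the values at its rightmost differing position, given the suffix parity p there.
Precedes : ℕ → ℕ → ℕ → Set
Precedes p a b = (p ≡ 0 × b < a) ⊎ (p ≡ 1 × a < b)

Precedes⇒≢ : Precedes p a b → a ≢ b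
Precedes⇒≢ (inj₁ (_ , b<a)) a≡b = <-irrefl (sym a≡b) b<a
Precedes⇒≢ (inj₂ (_ , a<b)) a≡b = <-irrefl a≡b a<b

precedes-adjacent-or-split : a ≤ m → b ≤ m → Precedes p a b →
  Adjacent a b ⊎ ∃[ v ] v ≤ m × Precedes p a v × Precedes p v b
precedes-adjacent-or-split {b = b} a≤m _ (inj₁ (p≡0 , b<a)) with m≤n⇒m<n∨m≡n b<a
... | inj₁ 1+b<a = inj₂ (suc b , ≤-trans b<a a≤m , inj₁ (p≡0 , 1+b<a) , inj₁ (p≡0 , n<1+n b))
... | inj₂ 1+b≡a = inj₁ (inj₁ (sym 1+b≡a))
precedes-adjacent-or-split {a = a} _ b≤m (inj₂ (p≡1 , a<b)) with m≤n⇒m<n∨m≡n a<b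
... | inj₁ 1+a<b = inj₂ (suc a , ≤-trans a<b b≤m , inj₂ (p≡1 , n<1+n a) , inj₂ (p≡1 , 1+a<b))
... | inj₂ 1+a≡b = inj₁ (inj₂ (sym 1+a≡b))

successor⊎predecessor : Opposite p q → a ≤ m → b ≤ m → a ≢ b →
  (∃[ v ] v ≤ m × Precedes p a v) ⊎ (∃[ v ] v ≤ m × Precedes q v b)
successor⊎predecessor {a = suc a} (inj₁ (p≡0 , _)) a≤m _ _ =
  inj₁ (a , ≤-trans (n≤1+n a) a≤m , inj₁ (p≡0 , n<1+n a))
successor⊎predecessor {a = zero} {b = suc b} (inj₁ (_ , q≡1)) _ b≤m _ =
  inj₂ (b , ≤-trans (n≤1+n b) b≤m , inj₂ (q≡1 , n<1+n b))
successor⊎predecessor {a = zero} {b = zero} (inj₁ _) _ _ a≢b = contradiction refl a≢b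
successor⊎predecessor {a = a} {b = b} (inj₂ (p≡1 , q≡0)) a≤m b≤m a≢b with m≤n⇒m<n∨m≡n a≤m
... | inj₁ a<m = inj₁ (suc a , a<m , inj₂ (p≡1 , n<1+n a))
... | inj₂ a≡m = inj₂ (suc b , ≤∧≢⇒< b≤m (λ b≡m → a≢b (trans a≡m (sym b≡m))) , inj₁ (q≡0 , n<1+n b))

_≺[_]_ : Seq n → Fin n → Seq n → Set
s ≺[ j ] t = RightmostDiff s t j × Precedes (suffixParity s j) (s j) (t j)

≺[]-intro : AgreeAbove j s t → Precedes (suffixParity s j) (s j) (t j) → s ≺[ j ] t
≺[]-intro s≡t prec = (Precedes⇒≢ prec , s≡t) , prec

≺[]-congʳ : s ≺[ j ] t → u j ≡ t j → AgreeAbove j u t → s ≺[ j ] u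
≺[]-congʳ ((_ , s≡t) , prec) uj≡tj u≡t =
  ≺[]-intro (λ k j<k → trans (s≡t k j<k) (sym (u≡t k j<k))) (subst (Precedes _ _) (sym uj≡tj) prec)

≺[]-congˡ : s ≺[ j ] t → u j ≡ s j → AgreeAbove j u s → u ≺[ j ] t
≺[]-congˡ {j = j} {t = t} ((_ , s≡t) , prec) uj≡sj u≡s =
  ≺[]-intro (λ k j<k → trans (u≡s k j<k) (s≡t k j<k))
    (subst₂ (λ p a → Precedes p a (t j)) (sym (suffixParity-cong u≡s)) (sym uj≡sj) prec)

_[_]≔_ : Seq n → Fin n → ℕ → Seq n
s [ i ]≔ v = updateAt s i (const v)

[]≔-updates : ∀ {s : Seq n} {i v} → (s [ i ]≔ v) i ≡ v
[]≔-updates {s = s} {i} = updateAt-updates i s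

[]≔-minimal : ∀ {s : Seq n} {i k v} → k ≢ i → (s [ i ]≔ v) k ≡ s k
[]≔-minimal {s = s} {i} {k} = updateAt-minimal k i s

[]≔-agreeAbove : ∀ {s : Seq n} {i v} → AgreeAbove i (s [ i ]≔ v) s
[]≔-agreeAbove {s = s} {i} k i<k = []≔-minimal {s = s} (λ k≡i → <⇒≢ i<k (sym k≡i))

[]≔-SE : ∀ {s : Seq n} {i v} → SE n s → v ≤ toℕ i → SE n (s [ i ]≔ v)
[]≔-SE {s = s} {i} sSE v≤i k with k ≟ᶠ i
... | yes refl = subst (_≤ toℕ k) (sym ([]≔-updates {s = s})) v≤i
... | no k≢i   = subst (_≤ toℕ k) (sym ([]≔-minimal {s = s} k≢i)) (sSE k)

≺[]-[]≔ : ∀ {s : Seq n} {i v} → Precedes (suffixParity s i) (s i) v → s ≺[ i ] (s [ i ]≔ v)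
≺[]-[]≔ {s = s} prec =
  ≺[]-intro (λ k i<k → sym ([]≔-agreeAbove {s = s} k i<k))
    (subst (Precedes _ _) (sym ([]≔-updates {s = s})) prec)

[]≔-≺[] : ∀ {t : Seq n} {i v} → Precedes (suffixParity t i) v (t i) → (t [ i ]≔ v) ≺[ i ] t
[]≔-≺[] {t = t} {i} prec =
  ≺[]-intro []≔-agreeAbove
    (subst₂ (λ p a → Precedes p a (t i))
      (sym (suffixParity-cong ([]≔-agreeAbove {s = t}))) (sym ([]≔-updates {s = t})) prec)

[]≔-below-agreeAbove : ∀ {s : Seq n} {i j v} → i F.< j → AgreeAbove j (s [ i ]≔ v) s
[]≔-below-agreeAbove {s = s} i<j k j<k = []≔-agreeAbove {s = s} k (<-trans i<j j<k)

≺[]-[]≔-below : ∀ {s t : Seq n} {i j v} → i F.< j → s ≺[ j ] t → s ≺[ j ] (t [ i ]≔ v)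
≺[]-[]≔-below {t = t} {j = j} i<j s≺t =
  ≺[]-congʳ s≺t ([]≔-agreeAbove {s = t} j i<j) ([]≔-below-agreeAbove {s = t} i<j)

[]≔-below-≺[] : ∀ {s t : Seq n} {i j v} → i F.< j → s ≺[ j ] t → (s [ i ]≔ v) ≺[ j ] t
[]≔-below-≺[] {s = s} {j = j} i<j s≺t =
  ≺[]-congˡ s≺t ([]≔-agreeAbove {s = s} j i<j) ([]≔-below-agreeAbove {s = s} i<j)

≺[]-split : ∀ {s t : Seq n} {j v} → s ≺[ j ] t →
  Precedes (suffixParity s j) (s j) v → Precedes (suffixParity s j) v (t j) →
  s ≺[ j ] (s [ j ]≔ v) × (s [ j ]≔ v) ≺[ j ] t
≺[]-split {s = s} {t} {j} ((_ , s≡t) , _) s→v v→t =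
  ≺[]-[]≔ s→v ,
  ≺[]-intro (λ k j<k → trans ([]≔-agreeAbove {s = s} k j<k) (s≡t k j<k))
    (subst₂ (λ p a → Precedes p a (t j))
      (sym (suffixParity-cong ([]≔-agreeAbove {s = s}))) (sym ([]≔-updates {s = s})) v→t)

NothingBetween : Seq n → Seq n → Set
NothingBetween {n} s t = (u : Seq n) → SE n u → ¬ (s ≺c u × u ≺c t)

module _ {s t : Seq n} {j : Fin n} (sSE : SE n s) (tSE : SE n t) (s≺t : s ≺[ j ] t)
         (gap : NothingBetween s t) where

  private
    between : SE n u → s ≺[ i ] u → u ≺[ k ] t → ⊥
    between uSE s≺u u≺t = gap _ uSE ((_ , s≺u) , (_ , u≺t))

  covered-adjacent : Adjacent (s j) (t j)
  covered-adjacent with precedes-adjacent-or-split (sSE j) (tSE j) (proj₂ s≺t)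
  ... | inj₁ sj~tj = sj~tj
  ... | inj₂ (v , v≤j , s→v , v→t) = ⊥-elim $
    between ([]≔-SE sSE v≤j) (proj₁ (≺[]-split s≺t s→v v→t)) (proj₂ (≺[]-split s≺t s→v v→t))

  no-last-difference-below : i F.< j → s i ≢ t i →
    ((k : Fin n) → i F.< k → k F.< j → s k ≡ t k) → ⊥
  no-last-difference-below {i = i} i<j si≢ti s≡t
    with successor⊎predecessor (suffixParity-opposite i<j covered-adjacent s≡t′) (sSE i) (tSE i) si≢ti
    where
    s≡t′ : (k : Fin n) → i F.< k → k ≢ j → s k ≡ t k
    s≡t′ k i<k k≢j with <-cmp k j
    ... | tri< k<j _ _ = s≡t k i<k k<j
    ... | tri≈ _ k≡j _ = contradiction k≡j k≢j
    ... | tri> _ _ j<k = proj₂ (proj₁ s≺t) k j<k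
  ... | inj₁ (v , v≤i , s→v) = between ([]≔-SE sSE v≤i) (≺[]-[]≔ s→v) ([]≔-below-≺[] i<j s≺t)
  ... | inj₂ (v , v≤i , v→t) = between ([]≔-SE tSE v≤i) (≺[]-[]≔-below i<j s≺t) ([]≔-≺[] v→t)

  covered-agree-below : (k : Fin n) → k F.< j → s k ≡ t k
  covered-agree-below = WF.All.wfRec >-wellFounded _ (λ k → k F.< j → s k ≡ t k) step
    where
    step : (k : Fin n) → (∀ {k′} → k F.< k′ → k′ F.< j → s k′ ≡ t k′) → k F.< j → s k ≡ t k
    step k s≡t k<j = decidable-stable (s k ≟ t k)
      (λ sk≢tk → no-last-difference-below k<j sk≢tk (λ k′ k<k′ → s≡t k<k′))

  covered-differ-only-at : (k : Fin n) → s k ≢ t k → k ≡ j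
  covered-differ-only-at k sk≢tk with <-cmp k j
  ... | tri< k<j _ _ = contradiction (covered-agree-below k k<j) sk≢tk
  ... | tri≈ _ k≡j _ = k≡j
  ... | tri> _ _ j<k = contradiction (proj₂ (proj₁ s≺t) k j<k) sk≢tk

unique-constant⇒length≤1 : ∀ {A : Set} {x : A} {xs : List A} → Unique xs → All (_≡ x) xs → length xs ≤ 1
unique-constant⇒length≤1 {xs = []}            _                 _                = z≤n
unique-constant⇒length≤1 {xs = _ ∷ []}        _                 _                = s≤s z≤n
unique-constant⇒length≤1 {xs = _ ∷ _ ∷ _}     ((y≢z ∷ _) ∷ _)   (refl ∷ refl ∷ _) = contradiction refl y≢z

hamming≤1 : (j : Fin n) → ((k : Fin n) → s k ≢ t k → k ≡ j) → hamming s t ≤ 1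
hamming≤1 {n = n} {s = s} {t = t} j differ⇒j =
  unique-constant⇒length≤1 (filter⁺ differ? (allFin⁺ n)) (All.map (differ⇒j _) (all-filter differ? (allFin n)))
  where
  differ? : (k : Fin n) → Dec (s k ≢ t k)
  differ? k = ¬? (s k ≟ t k)

theorem2 : (n : ℕ) → 1 ≤ n → (s t : Seq n) → SE n s → SE n t →
    s ≺c t → ((u : Seq n) → SE n u → ¬ (s ≺c u × u ≺c t)) →
    hamming s t ≤ 1
theorem2 n _ s t sSE tSE (j , s≺t) gap = hamming≤1 j (covered-differ-only-at sSE tSE s≺t gap)
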